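{- Let $G$ be a graph, $v$ a vertex of $G$, and $U=U_vG$ the universal homotopy cover. For every vertex $u$ of $U$ there exists a unique arrow in $\Pi(U)$ from $[v]$ to $u$.
   Context: All graphs are undirected, have no multiple edges, may have loops, are connected, and are not a single isolated vertex. A walk is a sequence $(v_0\cdots v_n)$ with $v_i\sim v_{i+1}$. A prune of a walk with $v_i=v_{i+2}$ replaces the segment $v_iv_{i+1}v_i$ by $v_i$; a spider move on $(v_0\cdots v_n)$ replaces one vertex $v_i$, $0<i<n$, by $v_i'$ with $v_{i-1}\sim v_i'\sim v_{i+1}$; walks are equivalent if connected by finitely many prunes, inverse prunes and spider moves. The fundamental groupoid $\Pi(G)$ has objects the vertices and arrows $x\to y$ the equivalence classes of walks from $x$ to $y$, composed by concatenation ($\alpha*\beta$ = $\alpha$ then $\beta$); $\Pi_v(G)$ is the set of arrows with source $v$. $U_vG$ is the graph whose vertices are the arrows of $\Pi_v(G)$, with $\alpha\sim\beta$ iff $\beta=\alpha*[(wx)]$ for an edge $w\sim x$ of $G$ with $w$ the target of $\alpha$; $[v]$ is the class of the length-0 walk $(v)$. $\Pi(U)$ is the fundamental groupoid of the graph $U$ defined in the same way. -}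

module Defs where

open import Data.List using (List; []; _∷_; _++_; [_])
open import Data.List.Relation.Binary.Pointwise using (Pointwise)
open import Data.Product using (Σ; _×_; _,_; proj₁; proj₂)
open import Data.Unit using (⊤; tt)
open import Data.Empty using (⊥)
open import Relation.Binary.PropositionalEquality using (_≡_; refl)
open import Relation.Binary.Construct.Closure.Equivalence using (EqClosure)

-- Walks, their equivalence (prunes / inverse prunes / spider moves) and
-- arrows of the fundamental groupoid, for a vertex type V carrying an
-- equality _≈_ (used to model quotient vertex sets) and adjacency _~_.
-- For an ordinary graph _≈_ is _≡_.
module Walks {V : Set} (_≈_ : V → V → Set) (_~_ : V → V → Set) where

  IsWalk : List V → Set
  IsWalk []               = ⊥
  IsWalk (x ∷ [])         = ⊤
  IsWalk (x ∷ y ∷ rest)   = (x ~ y) × IsWalk (y ∷ rest)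

  lastOf : V → List V → V
  lastOf x []       = x
  lastOf x (y ∷ ys) = lastOf y ys

  data Step : List V → List V → Set where
    pointwise : ∀ {p q} → Pointwise _≈_ p q → Step p q
    prune : ∀ pre a b c post → a ≈ c →
            Step (pre ++ a ∷ b ∷ c ∷ post) (pre ++ a ∷ post)
    spider : ∀ pre a b b′ c post → a ~ b′ → b′ ~ c →
             Step (pre ++ a ∷ b ∷ c ∷ post) (pre ++ a ∷ b′ ∷ c ∷ post)

  WalkStep : List V → List V → Set
  WalkStep p q = IsWalk p × IsWalk q × Step p q

  _≃_ : List V → List V → Set
  _≃_ = EqClosure WalkStep

  -- representatives of arrows x → y: walks (x ∷ rest) ending at y
  record Walk (x y : V) : Set where
    constructor walk
    field
      rest   : List V
      isWalk : IsWalk (x ∷ rest)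
      ends   : lastOf x rest ≈ y
  open Walk public

  _≈Arrow_ : ∀ {x y} → Walk x y → Walk x y → Set
  _≈Arrow_ {x} a b = (x ∷ rest a) ≃ (x ∷ rest b)

-- A graph: undirected (symmetric adjacency, loops allowed, no multiple
-- edges since adjacency is a relation), connected, and not a single
-- isolated vertex (it has an edge).
record Graph : Set₁ where
  field
    V         : Set
    _~_       : V → V → Set
    ~-sym     : ∀ {x y} → x ~ y → y ~ x
    connected : ∀ x y → Walks.Walk {V} _≡_ _~_ x y
    hasEdge   : Σ V λ x → Σ V λ y → x ~ y

record SGraph : Set₁ where
  field
    V   : Set
    _≈_ : V → V → Set
    _~_ : V → V → Set

module Cover (G : Graph) (v : Graph.V G) where
  open Graph G
  open Walks {V} _≡_ _~_

  -- Π_v(G): arrows with source v (target, representative walk)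
  UV : Set
  UV = Σ V λ y → Walk v y

  _≈U_ : UV → UV → Set
  α ≈U β = (v ∷ rest (proj₂ α)) ≃ (v ∷ rest (proj₂ β))

  _~U_ : UV → UV → Set
  α ~U β = Σ V λ x → (proj₁ α ~ x) ×
           ((v ∷ rest (proj₂ α) ++ [ x ]) ≃ (v ∷ rest (proj₂ β)))

  U : SGraph
  U = record { V = UV ; _≈_ = _≈U_ ; _~_ = _~U_ }

  base : UV
  base = v , walk [] tt refl

UGraph : (G : Graph) → Graph.V G → SGraph
UGraph G v = Cover.U G v

baseU : (G : Graph) (v : Graph.V G) → SGraph.V (UGraph G v)
baseU G v = Cover.base G v

ArrowU : (G : Graph) (v : Graph.V G) → (u u′ : SGraph.V (UGraph G v)) → Set
ArrowU G v u u′ = Walks.Walk (SGraph._≈_ (UGraph G v)) (SGraph._~_ (UGraph G v)) u u′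

_≈ΠU_ : ∀ {G v u u′} → ArrowU G v u u′ → ArrowU G v u u′ → Set
_≈ΠU_ {G} {v} a b = Walks._≈Arrow_ (SGraph._≈_ (UGraph G v)) (SGraph._~_ (UGraph G v)) a b

-- A vertex u of U is the class of a walk (v r) of G, and the prefixes of (v r)
-- form a walk in U from [v] to u.  Conversely, if β₀ = [v], β₁, …, βₖ = u is a
-- walk in U then βᵢ₊₁ = βᵢ * [(w xᵢ)], so the βᵢ are pointwise equal in U to the
-- prefixes of (v x₁ … xₖ), a walk equivalent to (v r).  It remains to see that
-- equivalent walks of G have equivalent prefix walks in U: a prune or spider
-- move on (v r) becomes, on the sequence of prefixes, pointwise equalities
-- followed by a single prune or spider move in U.
module Submission where

open import Defs
open import Data.List using (List; []; _∷_; _++_; [_]; head; map)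
open import Data.List.Properties using (++-assoc; ++-identityʳ; ∷-injectiveʳ)
open import Data.List.Relation.Binary.Pointwise as Pointwise
  using (Pointwise; []; _∷_; Pointwise-≡⇒≡)
open import Data.List.Relation.Unary.All as All using (All; []; _∷_)
import Data.List.Relation.Unary.All.Properties as All
open import Data.Maybe using (just)
open import Data.Maybe.Properties using (just-injective)
open import Data.Product using (Σ; ∃; _×_; _,_; proj₂)
open import Data.Sum using (_⊎_; inj₁; inj₂)
open import Data.Unit using (tt)
open import Relation.Binary.PropositionalEquality
  using (_≡_; refl; sym; trans; cong; subst; subst₂)
open import Relation.Binary.Construct.Closure.Equivalence using (symmetric; return; setoid)
open import Relation.Binary.Construct.Closure.ReflexiveTransitive using (ε; _◅_; _◅◅_)
open import Relation.Binary.Construct.Closure.Symmetric using (fwd; bwd)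
import Relation.Binary.Reasoning.Setoid

module WalkProperties {V : Set} (_≈_ _~_ : V → V → Set) where
  open Walks _≈_ _~_

  ≡⇒≃ : ∀ {P Q} → P ≡ Q → P ≃ Q
  ≡⇒≃ refl = ε

  ≃-sym : ∀ {P Q} → P ≃ Q → Q ≃ P
  ≃-sym = symmetric WalkStep

  ≋⇒≃ : ∀ {P Q} → IsWalk P → IsWalk Q → Pointwise _≈_ P Q → P ≃ Q
  ≋⇒≃ wP wQ P≋Q = return (wP , wQ , pointwise P≋Q)

  ≃-IsWalk : ∀ {P Q} → P ≃ Q → IsWalk P → IsWalk Q
  ≃-IsWalk ε                     wP = wP
  ≃-IsWalk (fwd (_ , wM , _) ◅ e) _ = ≃-IsWalk e wM
  ≃-IsWalk (bwd (wM , _ , _) ◅ e) _ = ≃-IsWalk e wM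

  lastOf-++ : ∀ d P Q → lastOf d (P ++ Q) ≡ lastOf (lastOf d P) Q
  lastOf-++ d []      Q = refl
  lastOf-++ d (x ∷ P) Q = lastOf-++ x P Q

  lastOf-≋ : ∀ {x y P Q} → x ≈ y → Pointwise _≈_ P Q → lastOf x P ≈ lastOf y Q
  lastOf-≋ x≈y []          = x≈y
  lastOf-≋ _   (x≈y ∷ P≋Q) = lastOf-≋ x≈y P≋Q

  IsWalk-++⁺ : ∀ d {P Q} → IsWalk P → IsWalk (lastOf d P ∷ Q) → IsWalk (P ++ Q)
  IsWalk-++⁺ d {x ∷ []}    _        wQ = wQ
  IsWalk-++⁺ d {x ∷ y ∷ P} (a , wP) wQ = a , IsWalk-++⁺ d wP wQ

  IsWalk-++⁻ˡ : ∀ {x} P {Q} → IsWalk (x ∷ P ++ Q) → IsWalk (x ∷ P)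
  IsWalk-++⁻ˡ []      _       = tt
  IsWalk-++⁻ˡ (y ∷ P) (a , w) = a , IsWalk-++⁻ˡ P w

  IsWalk-++⁻ʳ : ∀ {x} P {Q} → IsWalk (x ∷ P ++ Q) → IsWalk (lastOf x P ∷ Q)
  IsWalk-++⁻ʳ []      w       = w
  IsWalk-++⁻ʳ (y ∷ P) (_ , w) = IsWalk-++⁻ʳ P w

  IsWalk-adjacent : ∀ P {x y Q} → IsWalk (P ++ x ∷ y ∷ Q) → x ~ y
  IsWalk-adjacent []          (a , _) = a
  IsWalk-adjacent (_ ∷ [])    (_ , w) = IsWalk-adjacent [] w
  IsWalk-adjacent (_ ∷ p ∷ P) (_ , w) = IsWalk-adjacent (p ∷ P) w

  IsWalk-resp-≋ : (∀ {x x′ y} → x ≈ x′ → x ~ y → x′ ~ y) →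
                  (∀ {x y y′} → y ≈ y′ → x ~ y → x ~ y′) →
                  ∀ {P Q} → Pointwise _≈_ P Q → IsWalk P → IsWalk Q
  IsWalk-resp-≋ respˡ respʳ []                 ()
  IsWalk-resp-≋ respˡ respʳ (_ ∷ [])           _       = tt
  IsWalk-resp-≋ respˡ respʳ (x≈ ∷ y≈ ∷ P≋Q) (a , w) =
    respʳ y≈ (respˡ x≈ a) , IsWalk-resp-≋ respˡ respʳ (y≈ ∷ P≋Q) w

module GraphWalkProperties {V : Set} (_~_ : V → V → Set) where
  open Walks _≡_ _~_
  open WalkProperties _≡_ _~_

  step-head : ∀ {P Q} → Step P Q → head P ≡ head Q
  step-head (pointwise P≋Q)                = cong head (Pointwise-≡⇒≡ P≋Q)
  step-head (prune []      _ _ _ _ _)     = refl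
  step-head (prune (_ ∷ _) _ _ _ _ _)     = refl
  step-head (spider []      _ _ _ _ _ _ _) = refl
  step-head (spider (_ ∷ _) _ _ _ _ _ _ _) = refl

  head≡just : ∀ {P : List V} {x} → head P ≡ just x → ∃ λ r → P ≡ x ∷ r
  head≡just {y ∷ r} eq = r , cong (_∷ r) (just-injective eq)

  step-lastOf : ∀ {P Q} → Step P Q → ∀ d → lastOf d P ≡ lastOf d Q
  step-lastOf (pointwise P≋Q) d = cong (lastOf d) (Pointwise-≡⇒≡ P≋Q)
  step-lastOf (prune pre a b _ post refl) d =
    trans (lastOf-++ d pre (a ∷ b ∷ a ∷ post)) (sym (lastOf-++ d pre (a ∷ post)))
  step-lastOf (spider pre a b b′ c post _ _) d =
    trans (lastOf-++ d pre (a ∷ b ∷ c ∷ post)) (sym (lastOf-++ d pre (a ∷ b′ ∷ c ∷ post)))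

  step-++ʳ : ∀ {P Q} X → Step P Q → Step (P ++ X) (Q ++ X)
  step-++ʳ X (pointwise P≋Q) = pointwise (Pointwise.++⁺ P≋Q (Pointwise.refl refl))
  step-++ʳ X (prune pre a b c post e) =
    subst₂ Step (sym (++-assoc pre _ X)) (sym (++-assoc pre _ X))
      (prune pre a b c (post ++ X) e)
  step-++ʳ X (spider pre a b b′ c post ab′ b′c) =
    subst₂ Step (sym (++-assoc pre _ X)) (sym (++-assoc pre _ X))
      (spider pre a b b′ c (post ++ X) ab′ b′c)

  ≃-++ʳ : ∀ d {P Q X} → P ≃ Q → IsWalk (lastOf d P ∷ X) → (P ++ X) ≃ (Q ++ X)
  ≃-++ʳ d                 ε                       w = ε
  ≃-++ʳ d {P} {Q} {X} (fwd (wP , wM , s) ◅ e) w =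
    fwd (IsWalk-++⁺ d wP w , IsWalk-++⁺ d wM w′ , step-++ʳ X s) ◅ ≃-++ʳ d e w′
    where w′ = subst (λ y → IsWalk (y ∷ X)) (step-lastOf s d) w
  ≃-++ʳ d {P} {Q} {X} (bwd (wM , wP , s) ◅ e) w =
    bwd (IsWalk-++⁺ d wM w′ , IsWalk-++⁺ d wP w , step-++ʳ X s) ◅ ≃-++ʳ d e w′
    where w′ = subst (λ y → IsWalk (y ∷ X)) (sym (step-lastOf s d)) w

  step-∷ : ∀ x {P Q} → Step P Q → Step (x ∷ P) (x ∷ Q)
  step-∷ x (pointwise P≋Q)                = pointwise (refl ∷ P≋Q)
  step-∷ x (prune pre a b c post e)        = prune (x ∷ pre) a b c post e
  step-∷ x (spider pre a b b′ c post p q) = spider (x ∷ pre) a b b′ c post p q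

  data RootedStep (x : V) : List V → List V → Set where
    prune  : ∀ A b Q → RootedStep x (A ++ b ∷ lastOf x A ∷ Q) (A ++ Q)
    spider : ∀ A b b′ c Q → lastOf x A ~ b′ → b′ ~ c →
             RootedStep x (A ++ b ∷ c ∷ Q) (A ++ b′ ∷ c ∷ Q)

  RootedStep⇒Step : ∀ {x r r′} → RootedStep x r r′ → Step (x ∷ r) (x ∷ r′)
  RootedStep⇒Step {x} (prune A b Q) = prune-at x A
    where
    prune-at : ∀ x A → Step (x ∷ A ++ b ∷ lastOf x A ∷ Q) (x ∷ A ++ Q)
    prune-at x []      = prune [] x b x Q refl
    prune-at x (y ∷ A) = step-∷ x (prune-at y A)
  RootedStep⇒Step {x} (spider A b b′ c Q ab′ b′c) = spider-at x A ab′
    where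
    spider-at : ∀ x A → lastOf x A ~ b′ → Step (x ∷ A ++ b ∷ c ∷ Q) (x ∷ A ++ b′ ∷ c ∷ Q)
    spider-at x []      xb′ = spider [] x b b′ c Q xb′ b′c
    spider-at x (y ∷ A) yb′ = step-∷ x (spider-at y A yb′)

  rooted-∷ : ∀ {x y r r′} → RootedStep y r r′ → RootedStep x (y ∷ r) (y ∷ r′)
  rooted-∷ {y = y} (prune A b Q)           = prune (y ∷ A) b Q
  rooted-∷ {y = y} (spider A b b′ c Q p q) = spider (y ∷ A) b b′ c Q p q

  Step⇒RootedStep : ∀ {P Q x r r′} → Step P Q → P ≡ x ∷ r → Q ≡ x ∷ r′ →
                    r ≡ r′ ⊎ RootedStep x r r′
  Step⇒RootedStep (pointwise P≋Q) refl eq =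
    inj₁ (∷-injectiveʳ (trans (Pointwise-≡⇒≡ P≋Q) eq))
  Step⇒RootedStep (prune [] a b _ post refl) refl refl = inj₂ (prune [] b post)
  Step⇒RootedStep (prune (x ∷ pre) a b _ post refl) refl refl = inj₂ (pruned x pre)
    where
    pruned : ∀ x pre → RootedStep x (pre ++ a ∷ b ∷ a ∷ post) (pre ++ a ∷ post)
    pruned x []        = rooted-∷ (prune [] b post)
    pruned x (y ∷ pre) = rooted-∷ (pruned y pre)
  Step⇒RootedStep (spider [] a b b′ c post ab′ b′c) refl refl =
    inj₂ (spider [] b b′ c post ab′ b′c)
  Step⇒RootedStep (spider (x ∷ pre) a b b′ c post ab′ b′c) refl refl = inj₂ (spidered x pre)
    where
    spidered : ∀ x pre → RootedStep x (pre ++ a ∷ b ∷ c ∷ post) (pre ++ a ∷ b′ ∷ c ∷ post)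
    spidered x []        = rooted-∷ (spider [] b b′ c post ab′ b′c)
    spidered x (y ∷ pre) = rooted-∷ (spidered y pre)

  prune-end : ∀ x A b → Step (x ∷ (A ++ [ b ]) ++ [ lastOf x A ]) (x ∷ A)
  prune-end x A b =
    subst₂ Step (cong (x ∷_) (sym (++-assoc A [ b ] _))) (cong (x ∷_) (++-identityʳ A))
      (RootedStep⇒Step (prune A b []))

  spider-end : ∀ x A b b′ c → lastOf x A ~ b′ → b′ ~ c →
               Step (x ∷ (A ++ [ b ]) ++ [ c ]) (x ∷ (A ++ [ b′ ]) ++ [ c ])
  spider-end x A b b′ c ab′ b′c =
    subst₂ Step (cong (x ∷_) (sym (++-assoc A [ b ] [ c ]))) (cong (x ∷_) (sym (++-assoc A [ b′ ] [ c ])))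
      (RootedStep⇒Step (spider A b b′ c [] ab′ b′c))

module UniversalCover (G : Graph) (v : Graph.V G) where
  open Graph G
  open Cover G v
  module GW = Walks _≡_ _~_
  open GW using (lastOf)
  module GP = WalkProperties {V} _≡_ _~_
  open GraphWalkProperties {V} _~_
  module UW = Walks _≈U_ _~U_
  module UP = WalkProperties _≈U_ _~U_

  _≃ᴳ_ : List V → List V → Set
  _≃ᴳ_ = GW._≃_

  _≃ᵤ_ : List UV → List UV → Set
  _≃ᵤ_ = UW._≃_

  IsWalkFromV : List V → Set
  IsWalkFromV r = GW.IsWalk (v ∷ r)

  -- A list r stands for the vertex [(v r)] of U; these are the relations of U on
  -- such representatives, which carry no walk proofs (those are added by lift).
  _≈ᵣ_ : List V → List V → Set
  r ≈ᵣ r′ = (v ∷ r) ≃ᴳ (v ∷ r′)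

  _~ᵣ_ : List V → List V → Set
  r ~ᵣ r′ = Σ V λ x → (lastOf v r ~ x) × ((v ∷ r ++ [ x ]) ≃ᴳ (v ∷ r′))

  module RW = Walks _≈ᵣ_ _~ᵣ_
  module RP = WalkProperties _≈ᵣ_ _~ᵣ_

  _≃ᵣ_ : List (List V) → List (List V) → Set
  _≃ᵣ_ = RW._≃_

  ~ᵣ-respˡ : ∀ {r r′ s} → r ≈ᵣ r′ → r ~ᵣ s → r′ ~ᵣ s
  ~ᵣ-respˡ r≈ (x , a , e) =
    x , subst (_~ x) (≃-lastOf r≈) a , GP.≃-sym (≃-++ʳ v r≈ (a , tt)) ◅◅ e
    where
    ≃-lastOf : ∀ {P Q} → P ≃ᴳ Q → lastOf v P ≡ lastOf v Q
    ≃-lastOf ε                       = refl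
    ≃-lastOf (fwd (_ , _ , s) ◅ e) = trans (step-lastOf s v) (≃-lastOf e)
    ≃-lastOf (bwd (_ , _ , s) ◅ e) = trans (sym (step-lastOf s v)) (≃-lastOf e)

  ~ᵣ-respʳ : ∀ {r s s′} → s ≈ᵣ s′ → r ~ᵣ s → r ~ᵣ s′
  ~ᵣ-respʳ s≈ (x , a , e) = x , a , e ◅◅ s≈

  IsWalkᵣ-resp-≋ : ∀ {R R′} → Pointwise _≈ᵣ_ R R′ → RW.IsWalk R → RW.IsWalk R′
  IsWalkᵣ-resp-≋ = RP.IsWalk-resp-≋ ~ᵣ-respˡ ~ᵣ-respʳ

  ~ᵣ-IsWalkFromV : ∀ {r r′} → r ~ᵣ r′ → IsWalkFromV r → IsWalkFromV r′
  ~ᵣ-IsWalkFromV (x , a , e) w = GP.≃-IsWalk e (GP.IsWalk-++⁺ v w (a , tt))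

  IsWalkᵣ⇒All : ∀ {r R} → RW.IsWalk (r ∷ R) → IsWalkFromV r → All IsWalkFromV R
  IsWalkᵣ⇒All {R = []}    _       _ = []
  IsWalkᵣ⇒All {R = _ ∷ _} (a , h) w = w′ ∷ IsWalkᵣ⇒All h w′
    where w′ = ~ᵣ-IsWalkFromV a w

  extensions : List V → List V → List (List V)
  extensions s []      = []
  extensions s (x ∷ T) = (s ++ [ x ]) ∷ extensions (s ++ [ x ]) T

  prefixes : List V → List (List V)
  prefixes r = [] ∷ extensions [] r

  extensions-++ : ∀ s A X → extensions s (A ++ X) ≡ extensions s A ++ extensions (s ++ A) X
  extensions-++ s []      X = cong (λ s′ → extensions s′ X) (sym (++-identityʳ s))
  extensions-++ s (a ∷ A) X = cong ((s ++ [ a ]) ∷_) (begin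
    extensions (s ++ [ a ]) (A ++ X)
      ≡⟨ extensions-++ (s ++ [ a ]) A X ⟩
    extensions (s ++ [ a ]) A ++ extensions ((s ++ [ a ]) ++ A) X
      ≡⟨ cong (λ s′ → extensions (s ++ [ a ]) A ++ extensions s′ X) (++-assoc s [ a ] A) ⟩
    extensions (s ++ [ a ]) A ++ extensions (s ++ a ∷ A) X ∎)
    where open Relation.Binary.PropositionalEquality.≡-Reasoning

  prefixes-++ : ∀ A X → prefixes (A ++ X) ≡ prefixes A ++ extensions A X
  prefixes-++ A X = cong ([] ∷_) (extensions-++ [] A X)

  extensions-∷ʳ : ∀ s T → ∃ λ C → s ∷ extensions s T ≡ C ++ [ s ++ T ]
  extensions-∷ʳ s []      = [] , cong [_] (sym (++-identityʳ s))
  extensions-∷ʳ s (x ∷ T) with extensions-∷ʳ (s ++ [ x ]) T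
  ... | C , eq = s ∷ C , cong (s ∷_) (trans eq (cong (λ s′ → C ++ [ s′ ]) (++-assoc s [ x ] T)))

  at-prefixes : ∀ A {X Y} → (∀ C → RW.Step (C ++ A ∷ X) (C ++ A ∷ Y)) →
                RW.Step (prefixes A ++ X) (prefixes A ++ Y)
  at-prefixes A step with extensions-∷ʳ [] A
  ... | C , eq = subst₂ RW.Step (sym (shift _)) (sym (shift _)) (step C)
    where
    shift : ∀ X → prefixes A ++ X ≡ C ++ A ∷ X
    shift X = trans (cong (_++ X) eq) (++-assoc C [ A ] X)

  extensions-IsWalk : ∀ s T → GW.IsWalk (lastOf v s ∷ T) → RW.IsWalk (s ∷ extensions s T)
  extensions-IsWalk s []      _       = tt
  extensions-IsWalk s (x ∷ T) (a , w) =
    (x , a , ε) , extensions-IsWalk (s ++ [ x ]) T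
                    (subst (λ y → GW.IsWalk (y ∷ T)) (sym (GP.lastOf-++ v s [ x ])) w)

  prefixes-IsWalk : ∀ {r} → IsWalkFromV r → RW.IsWalk (prefixes r)
  prefixes-IsWalk {r} = extensions-IsWalk [] r

  extensions-≋ : ∀ {s s′} T → s ≈ᵣ s′ → GW.IsWalk (lastOf v s ∷ T) →
                 Pointwise _≈ᵣ_ (extensions s T) (extensions s′ T)
  extensions-≋ []      _  _       = []
  extensions-≋ {s} (x ∷ T) s≈ (a , w) =
    sx≈ ∷ extensions-≋ T sx≈ (subst (λ y → GW.IsWalk (y ∷ T)) (sym (GP.lastOf-++ v s [ x ])) w)
    where sx≈ = ≃-++ʳ v s≈ (a , tt)

  ++-∷ʳ-∷ʳ : ∀ (A : List V) b c Q → ((A ++ [ b ]) ++ [ c ]) ++ Q ≡ A ++ b ∷ c ∷ Q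
  ++-∷ʳ-∷ʳ A b c Q = trans (++-assoc (A ++ [ b ]) [ c ] Q) (++-assoc A [ b ] (c ∷ Q))

  module RawReasoning = Relation.Binary.Reasoning.Setoid (setoid RW.WalkStep)

  prefixes-prune : ∀ A b Q → IsWalkFromV (A ++ b ∷ lastOf v A ∷ Q) → IsWalkFromV (A ++ Q) →
                   prefixes (A ++ b ∷ lastOf v A ∷ Q) ≃ᵣ prefixes (A ++ Q)
  prefixes-prune A b Q w w′ = begin
    prefixes (A ++ b ∷ a ∷ Q)                 ≡⟨ prefixes-++ A (b ∷ a ∷ Q) ⟩
    prefixes A ++ Ab ∷ Aba ∷ extensions Aba Q ≈⟨ RP.≋⇒≃ h₀ h₁ pw ⟩
    prefixes A ++ Ab ∷ A ∷ extensions A Q     ≈⟨ return (h₁ , h₂ , at-prefixes A λ C →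
                                                   RW.prune C A Ab A (extensions A Q) ε) ⟩
    prefixes A ++ extensions A Q              ≡⟨ sym (prefixes-++ A Q) ⟩
    prefixes (A ++ Q)                         ∎
    where
    open RawReasoning
    a   = lastOf v A
    Ab  = A ++ [ b ]
    Aba = Ab ++ [ a ]
    wAba : IsWalkFromV (Aba ++ Q)
    wAba = subst IsWalkFromV (sym (++-∷ʳ-∷ʳ A b a Q)) w
    Aba≈A : Aba ≈ᵣ A
    Aba≈A = return (GP.IsWalk-++⁻ˡ Aba wAba , GP.IsWalk-++⁻ˡ A w′ , prune-end v A b)
    pw : Pointwise _≈ᵣ_ (prefixes A ++ Ab ∷ Aba ∷ extensions Aba Q)
                        (prefixes A ++ Ab ∷ A ∷ extensions A Q)
    pw = Pointwise.++⁺ (Pointwise.refl ε {prefixes A})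
           (ε ∷ Aba≈A ∷ extensions-≋ Q Aba≈A (GP.IsWalk-++⁻ʳ Aba wAba))
    h₀ : RW.IsWalk (prefixes A ++ Ab ∷ Aba ∷ extensions Aba Q)
    h₀ = subst RW.IsWalk (prefixes-++ A (b ∷ a ∷ Q)) (prefixes-IsWalk w)
    h₁ : RW.IsWalk (prefixes A ++ Ab ∷ A ∷ extensions A Q)
    h₁ = IsWalkᵣ-resp-≋ pw h₀
    h₂ : RW.IsWalk (prefixes A ++ extensions A Q)
    h₂ = subst RW.IsWalk (prefixes-++ A Q) (prefixes-IsWalk w′)

  prefixes-spider : ∀ A b b′ c Q → lastOf v A ~ b′ → b′ ~ c →
                    IsWalkFromV (A ++ b ∷ c ∷ Q) → IsWalkFromV (A ++ b′ ∷ c ∷ Q) →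
                    prefixes (A ++ b ∷ c ∷ Q) ≃ᵣ prefixes (A ++ b′ ∷ c ∷ Q)
  prefixes-spider A b b′ c Q ab′ b′c w w′ = begin
    prefixes (A ++ b ∷ c ∷ Q)                    ≡⟨ prefixes-++ A (b ∷ c ∷ Q) ⟩
    prefixes A ++ Ab ∷ Abc ∷ extensions Abc Q    ≈⟨ RP.≋⇒≃ h₀ h₁ pw ⟩
    prefixes A ++ Ab ∷ Ab′c ∷ extensions Ab′c Q  ≈⟨ return (h₁ , h₂ , at-prefixes A λ C →
                                                      RW.spider C A Ab Ab′ Ab′c (extensions Ab′c Q)
                                                        (b′ , ab′ , ε) (c , Ab′c-adj , ε)) ⟩
    prefixes A ++ Ab′ ∷ Ab′c ∷ extensions Ab′c Q ≡⟨ sym (prefixes-++ A (b′ ∷ c ∷ Q)) ⟩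
    prefixes (A ++ b′ ∷ c ∷ Q)                   ∎
    where
    open RawReasoning
    Ab   = A ++ [ b ]
    Ab′  = A ++ [ b′ ]
    Abc  = Ab ++ [ c ]
    Ab′c = Ab′ ++ [ c ]
    Ab′c-adj : lastOf v Ab′ ~ c
    Ab′c-adj = subst (_~ c) (sym (GP.lastOf-++ v A [ b′ ])) b′c
    wAbc : IsWalkFromV (Abc ++ Q)
    wAbc = subst IsWalkFromV (sym (++-∷ʳ-∷ʳ A b c Q)) w
    wAb′c : IsWalkFromV (Ab′c ++ Q)
    wAb′c = subst IsWalkFromV (sym (++-∷ʳ-∷ʳ A b′ c Q)) w′
    Abc≈Ab′c : Abc ≈ᵣ Ab′c
    Abc≈Ab′c = return (GP.IsWalk-++⁻ˡ Abc wAbc , GP.IsWalk-++⁻ˡ Ab′c wAb′c ,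
                       spider-end v A b b′ c ab′ b′c)
    pw : Pointwise _≈ᵣ_ (prefixes A ++ Ab ∷ Abc ∷ extensions Abc Q)
                        (prefixes A ++ Ab ∷ Ab′c ∷ extensions Ab′c Q)
    pw = Pointwise.++⁺ (Pointwise.refl ε {prefixes A})
           (ε ∷ Abc≈Ab′c ∷ extensions-≋ Q Abc≈Ab′c (GP.IsWalk-++⁻ʳ Abc wAbc))
    h₀ : RW.IsWalk (prefixes A ++ Ab ∷ Abc ∷ extensions Abc Q)
    h₀ = subst RW.IsWalk (prefixes-++ A (b ∷ c ∷ Q)) (prefixes-IsWalk w)
    h₁ : RW.IsWalk (prefixes A ++ Ab ∷ Ab′c ∷ extensions Ab′c Q)
    h₁ = IsWalkᵣ-resp-≋ pw h₀
    h₂ : RW.IsWalk (prefixes A ++ Ab′ ∷ Ab′c ∷ extensions Ab′c Q)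
    h₂ = subst RW.IsWalk (prefixes-++ A (b′ ∷ c ∷ Q)) (prefixes-IsWalk w′)

  prefixes-step : ∀ {r r′} → GW.Step (v ∷ r) (v ∷ r′) → IsWalkFromV r → IsWalkFromV r′ →
                  prefixes r ≃ᵣ prefixes r′
  prefixes-step s w w′ with Step⇒RootedStep s refl refl
  ... | inj₁ refl                           = ε
  ... | inj₂ (prune A b Q)                  = prefixes-prune A b Q w w′
  ... | inj₂ (spider A b b′ c Q ab′ b′c) = prefixes-spider A b b′ c Q ab′ b′c w w′

  prefixes-≃ : ∀ {P Q r r′} → P ≃ᴳ Q → P ≡ v ∷ r → Q ≡ v ∷ r′ → prefixes r ≃ᵣ prefixes r′
  prefixes-≃ ε refl eq = RP.≡⇒≃ (cong prefixes (∷-injectiveʳ eq))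
  prefixes-≃ (fwd (wP , wM , s) ◅ e) refl eq with head≡just (sym (step-head s))
  ... | _ , refl = prefixes-step s wP wM ◅◅ prefixes-≃ e refl eq
  prefixes-≃ (bwd (wM , wP , s) ◅ e) refl eq with head≡just (step-head s)
  ... | _ , refl = RP.≃-sym (prefixes-step s wM wP) ◅◅ prefixes-≃ e refl eq

  straighten : ∀ {s R} → RW.IsWalk (s ∷ R) → ∃ λ T → Pointwise _≈ᵣ_ R (extensions s T)
  straighten {R = []}    _                 = [] , []
  straighten {s} {r ∷ R} ((x , _ , e) , h) with straighten {s ++ [ x ]} {R} h′
    where h′ = IsWalkᵣ-resp-≋ (GP.≃-sym e ∷ Pointwise.refl ε) h
  ... | T , R≋ = x ∷ T , GP.≃-sym e ∷ R≋

  toU : (r : List V) → IsWalkFromV r → UV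
  toU r w = lastOf v r , GW.walk r w refl

  restOf : UV → List V
  restOf α = GW.rest (proj₂ α)

  lift : (R : List (List V)) → All IsWalkFromV R → List UV
  lift []      []       = []
  lift (r ∷ R) (w ∷ ws) = toU r w ∷ lift R ws

  lift-IsWalk : ∀ {R} → RW.IsWalk R → ∀ ws → UW.IsWalk (lift R ws)
  lift-IsWalk {_ ∷ []}    _       (_ ∷ [])  = tt
  lift-IsWalk {_ ∷ _ ∷ _} (a , h) (_ ∷ ws@(_ ∷ _)) = a , lift-IsWalk h ws

  lift-≋ : ∀ {R R′} → Pointwise _≈ᵣ_ R R′ → ∀ ws ws′ → Pointwise _≈U_ (lift R ws) (lift R′ ws′)
  lift-≋ []          []       []        = []
  lift-≋ (r≈ ∷ R≋) (_ ∷ ws) (_ ∷ ws′) = r≈ ∷ lift-≋ R≋ ws ws′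

  lift-irrelevant : ∀ {R} → RW.IsWalk R → ∀ ws ws′ → lift R ws ≃ᵤ lift R ws′
  lift-irrelevant h ws ws′ =
    UP.≋⇒≃ (lift-IsWalk h ws) (lift-IsWalk h ws′) (lift-≋ (Pointwise.refl ε) ws ws′)

  lift-++ : ∀ P {Q} (wP : All IsWalkFromV P) (wQ : All IsWalkFromV Q) →
            lift (P ++ Q) (All.++⁺ wP wQ) ≡ lift P wP ++ lift Q wQ
  lift-++ []      []       wQ = refl
  lift-++ (r ∷ P) (w ∷ wP) wQ = cong (toU r w ∷_) (lift-++ P wP wQ)

  lift-++-Step : ∀ pre {X Y} (wl : All IsWalkFromV pre) (wX : All IsWalkFromV X)
              (wY : All IsWalkFromV Y) → RW.IsWalk (pre ++ X) → RW.IsWalk (pre ++ Y) →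
              UW.Step (lift pre wl ++ lift X wX) (lift pre wl ++ lift Y wY) →
              ∀ ws ws′ → lift (pre ++ X) ws ≃ᵤ lift (pre ++ Y) ws′
  lift-++-Step pre wl wX wY h h′ s ws ws′ =
    lift-irrelevant h ws (All.++⁺ wl wX)
    ◅◅ return (lift-IsWalk h _ , lift-IsWalk h′ _ ,
               subst₂ UW.Step (sym (lift-++ pre wl wX)) (sym (lift-++ pre wl wY)) s)
    ◅◅ lift-irrelevant h′ (All.++⁺ wl wY) ws′

  lift-Step : ∀ {R R′} → RW.Step R R′ → RW.IsWalk R → RW.IsWalk R′ →
              ∀ ws ws′ → lift R ws ≃ᵤ lift R′ ws′
  lift-Step (RW.pointwise R≋) h h′ ws ws′ =
    UP.≋⇒≃ (lift-IsWalk h ws) (lift-IsWalk h′ ws′) (lift-≋ R≋ ws ws′)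
  lift-Step (RW.prune pre a b c post a≈c) h h′ ws ws′ with All.++⁻ pre ws
  ... | wl , wa ∷ wb ∷ wc ∷ wp =
    lift-++-Step pre wl (wa ∷ wb ∷ wc ∷ wp) (wa ∷ wp) h h′
      (UW.prune (lift pre wl) (toU a wa) (toU b wb) (toU c wc) (lift post wp) a≈c) ws ws′
  lift-Step (RW.spider pre a b b′ c post ab′ b′c) h h′ ws ws′ with All.++⁻ pre ws
  ... | wl , wa ∷ wb ∷ wc ∷ wp =
    lift-++-Step pre wl (wa ∷ wb ∷ wc ∷ wp) (wa ∷ wb′ ∷ wc ∷ wp) h h′
      (UW.spider (lift pre wl) (toU a wa) (toU b wb) (toU b′ wb′) (toU c wc) (lift post wp)
         ab′ b′c) ws ws′
    where wb′ = ~ᵣ-IsWalkFromV ab′ wa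

  ≋-All : ∀ {R R′} → Pointwise _≈ᵣ_ R R′ → All IsWalkFromV R → All IsWalkFromV R′
  ≋-All []          []       = []
  ≋-All (r≈ ∷ R≋) (w ∷ ws) = GP.≃-IsWalk r≈ w ∷ ≋-All R≋ ws

  step-All : ∀ {R R′} → RW.Step R R′ → All IsWalkFromV R → All IsWalkFromV R′
  step-All (RW.pointwise R≋) ws = ≋-All R≋ ws
  step-All (RW.prune pre _ _ _ _ _) ws with All.++⁻ pre ws
  ... | wl , wa ∷ _ ∷ _ ∷ wp = All.++⁺ wl (wa ∷ wp)
  step-All (RW.spider pre _ _ _ _ _ ab′ _) ws with All.++⁻ pre ws
  ... | wl , wa ∷ _ ∷ wc ∷ wp = All.++⁺ wl (wa ∷ ~ᵣ-IsWalkFromV ab′ wa ∷ wc ∷ wp)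

  step-All⁻ : ∀ {R R′} → RW.Step R R′ → RW.IsWalk R → All IsWalkFromV R′ → All IsWalkFromV R
  step-All⁻ (RW.pointwise R≋) _ ws = ≋-All (Pointwise.symmetric GP.≃-sym R≋) ws
  step-All⁻ (RW.prune pre _ _ _ _ a≈c) h ws with All.++⁻ pre ws
  ... | wl , wa ∷ wp =
    All.++⁺ wl (wa ∷ ~ᵣ-IsWalkFromV (RP.IsWalk-adjacent pre h) wa ∷ GP.≃-IsWalk a≈c wa ∷ wp)
  step-All⁻ (RW.spider pre _ _ _ _ _ _ _) h ws with All.++⁻ pre ws
  ... | wl , wa ∷ _ ∷ wc ∷ wp =
    All.++⁺ wl (wa ∷ ~ᵣ-IsWalkFromV (RP.IsWalk-adjacent pre h) wa ∷ wc ∷ wp)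

  lift-≃ᵣ : ∀ {R R′} → RW.IsWalk R → R ≃ᵣ R′ → ∀ ws ws′ → lift R ws ≃ᵤ lift R′ ws′
  lift-≃ᵣ h ε ws ws′ = lift-irrelevant h ws ws′
  lift-≃ᵣ h (fwd (_ , h′ , s) ◅ e) ws ws′ =
    lift-Step s h h′ ws wsₘ ◅◅ lift-≃ᵣ h′ e wsₘ ws′
    where wsₘ = step-All s ws
  lift-≃ᵣ h (bwd (h′ , _ , s) ◅ e) ws ws′ =
    UP.≃-sym (lift-Step s h′ h wsₘ ws) ◅◅ lift-≃ᵣ h′ e wsₘ ws′
    where wsₘ = step-All⁻ s h′ ws

  restOf-lastOf : ∀ s w T ws → restOf (UW.lastOf (toU s w) (lift (extensions s T) ws)) ≡ s ++ T
  restOf-lastOf s w []      []        = sym (++-identityʳ s)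
  restOf-lastOf s w (x ∷ T) (w′ ∷ ws) = trans (restOf-lastOf (s ++ [ x ]) w′ T ws) (++-assoc s [ x ] T)

  rests-IsWalk : ∀ {α P} → UW.IsWalk (α ∷ P) → RW.IsWalk (restOf α ∷ map restOf P)
  rests-IsWalk {P = []}    _                 = tt
  rests-IsWalk {α} {_ ∷ _} ((x , a , e) , h) =
    (x , subst (_~ x) (sym (GW.ends (proj₂ α))) a , e) , rests-IsWalk h

  rests-All : ∀ P → All IsWalkFromV (map restOf P)
  rests-All []      = []
  rests-All (α ∷ P) = GW.isWalk (proj₂ α) ∷ rests-All P

  ≋-lift : ∀ P {R} → Pointwise _≈ᵣ_ (map restOf P) R → ∀ ws → Pointwise _≈U_ P (lift R ws)
  ≋-lift []      []          []       = []
  ≋-lift (_ ∷ P) (r≈ ∷ R≋) (_ ∷ ws) = r≈ ∷ ≋-lift P R≋ ws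

  extensions-All : ∀ {r} → IsWalkFromV r → All IsWalkFromV (extensions [] r)
  extensions-All w = IsWalkᵣ⇒All (prefixes-IsWalk w) tt

  canonical : (u : UV) → UW.Walk base u
  canonical (_ , GW.walk r w _) =
    UW.walk (lift (extensions [] r) ws) (lift-IsWalk (prefixes-IsWalk w) (tt ∷ ws))
      (GP.≡⇒≃ (cong (v ∷_) (restOf-lastOf [] tt r ws)))
    where ws = extensions-All w

  canonical-unique : (u : UV) (b : UW.Walk base u) → UW._≈Arrow_ (canonical u) b
  canonical-unique (_ , GW.walk r w _) (UW.walk P h P-ends) with straighten (rests-IsWalk h)
  ... | T , P≋T = UP.≃-sym (P≃T ◅◅ lift-≃ᵣ hT (prefixes-≃ T≈r refl refl) (tt ∷ wsT) (tt ∷ wsr))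
    where
    wsT : All IsWalkFromV (extensions [] T)
    wsT = ≋-All P≋T (rests-All P)
    wsr : All IsWalkFromV (extensions [] r)
    wsr = extensions-All w
    hT : RW.IsWalk (prefixes T)
    hT = IsWalkᵣ-resp-≋ (ε ∷ P≋T) (rests-IsWalk h)
    P≋liftT : Pointwise _≈U_ P (lift (extensions [] T) wsT)
    P≋liftT = ≋-lift P P≋T wsT
    P≃T : (base ∷ P) ≃ᵤ lift (prefixes T) (tt ∷ wsT)
    P≃T = UP.≋⇒≃ h (lift-IsWalk hT _) (ε ∷ P≋liftT)
    T≈r : T ≈ᵣ r
    T≈r = GP.≡⇒≃ (cong (v ∷_) (sym (restOf-lastOf [] tt T wsT)))
          ◅◅ GP.≃-sym (UP.lastOf-≋ ε P≋liftT) ◅◅ P-ends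

lemma3p14 : (G : Graph) (v : Graph.V G) (u : SGraph.V (UGraph G v)) →
    Σ (ArrowU G v (baseU G v) u) λ a →
    (b : ArrowU G v (baseU G v) u) → _≈ΠU_ {G} {v} a b
lemma3p14 G v u = canonical u , canonical-unique u
  where open UniversalCover G v
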